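{- Let $\alpha,\beta,q\in\mathbb{Z}$ and let $(Z_n : NC^{\mathrm{(mton)}}(n)\to\mathbb{R})_{n\ge1}$ be recursive of the second kind with input $(\alpha,\beta;q)$, each $NC^{\mathrm{(mton)}}(n)$ carrying the uniform distribution. Then for every $n\ge2$, $$E[Z_n] = \frac{(n+1)+(\alpha-\beta)}{n+1}\,E[Z_{n-1}] + \frac{\alpha q + \beta((n+1)-q)}{n+1}.$$
   Context: $NC(n)$: non-crossing partitions of $\{1,\ldots,n\}$. For blocks $V,W$, "$V$ nested inside $W$" means $\min V>\min W$ and $\max V<\max W$. A monotonic ordering of $\pi\in NC(n)$ is a bijection $u:\pi\to\{1,\ldots,|\pi|\}$ with $u(V)>u(W)$ whenever $V$ is nested inside $W$; $NC^{\mathrm{(mton)}}(n)$ is the set of such pairs $(\pi,u)$. $J(\pi,u):=u^{ -1}(|\pi|)$ (an interval). For $n\ge2$, the parent $\mathfrak{p}(\pi,u)=(\rho,v)\in NC^{\mathrm{(mton)}}(n-1)$: with $m=\max J(\pi,u)$ and $\phi$ the increasing bijection $\{1,\ldots,n\}\setminus\{m\}\to\{1,\ldots,n-1\}$, $\rho=\{\phi(V\setminus\{m\}) : V\in\pi, V\ne\{m\}\}$ and $v(\phi(V\setminus\{m\}))=u(V)$. For $(\rho,v)\in NC^{\mathrm{(mton)}}(n-1)$, $C(\rho,v):=\{(\pi,u)\in NC^{\mathrm{(mton)}}(n) : \mathfrak{p}(\pi,u)=(\rho,v)\}$. A sequence $(Z_n)$ is recursive of the second kind with input $(\alpha,\beta;q)$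 if for every $n\ge2$ and $(\rho,v)\in NC^{\mathrm{(mton)}}(n-1)$ there is $C_o(\rho,v)\subseteq C(\rho,v)$ with $Z_n(\pi,u)=Z_{n-1}(\rho,v)+\alpha$ on $C_o(\rho,v)$, $Z_n(\pi,u)=Z_{n-1}(\rho,v)+\beta$ on $C(\rho,v)\setminus C_o(\rho,v)$, and $|C_o(\rho,v)|=Z_{n-1}(\rho,v)+q$. -}

module Defs where

open import Data.Bool using (Bool; true; false; _∧_; _∨_; not; if_then_else_; T)
open import Data.Nat as ℕ using (ℕ; zero; suc; _≤_; _⊔_; _≡ᵇ_; _<ᵇ_; _≤ᵇ_)
open import Data.Fin using (Fin; toℕ)
open import Data.Maybe using (Maybe; just; nothing)
open import Data.Bool.ListAction using (all; any)
open import Data.List using (List; []; _∷_; map; concatMap; filterᵇ; length; foldr; allFin; upTo)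
open import Data.Vec using (Vec; lookup; removeAt; toList)
import Data.Vec as Vec
open import Data.Vec.Properties using (≡-dec)
open import Data.Integer as ℤ using (ℤ; +_)
open import Data.Rational as ℚ using (ℚ)
open import Data.Product using (Σ; _×_)
open import Relation.Nullary using (does)
open import Relation.Binary.PropositionalEquality using (_≡_)

-- A monotonically ordered non-crossing partition (π , u) of
-- {1,…,n} is encoded by its labelling  w : Vec ℕ n,  where the entry at
-- position i is u(V) for the block V ∈ π containing i.  Blocks of π are
-- the level sets of w, and u is read off from the labels.  Positions
-- 1,…,n are represented by Fin n (order preserved).

private variable n : ℕ

Pos : (n : ℕ) → List (Fin n)
Pos n = allFin n

_<F_ : Fin n → Fin n → Bool
i <F j = toℕ i <ᵇ toℕ j

oneTo : ℕ → List ℕ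
oneTo k = map suc (upTo k)

numBlocks : Vec ℕ n → ℕ
numBlocks w = foldr _⊔_ 0 (toList w)

inBlock : Vec ℕ n → ℕ → Fin n → Bool
inBlock w j i = lookup w i ≡ᵇ j

-- u is a bijection onto {1,…,|π|}: every label is in 1..k and each of
-- 1..k is used (k = largest label = number of blocks)
labelsOk : Vec ℕ n → Bool
labelsOk {n} w =
  all (λ i → 1 ≤ᵇ lookup w i) (Pos n)
  ∧ all (λ j → any (inBlock w j) (Pos n)) (oneTo (numBlocks w))

nonCrossing : Vec ℕ n → Bool
nonCrossing {n} w =
  all (λ a → all (λ b → all (λ c → all (λ d →
    not ((a <F b) ∧ (b <F c) ∧ (c <F d)
         ∧ (lookup w a ≡ᵇ lookup w c) ∧ (lookup w b ≡ᵇ lookup w d)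
         ∧ not (lookup w a ≡ᵇ lookup w b)))
  (Pos n)) (Pos n)) (Pos n)) (Pos n)

-- block V = u⁻¹(j) is nested inside W = u⁻¹(l):
--   min V > min W  (some x ∈ W is below every y ∈ V)  and
--   max V < max W  (some x ∈ W is above every y ∈ V)
nested : Vec ℕ n → ℕ → ℕ → Bool
nested {n} w j l =
  any (λ x → inBlock w l x ∧ all (λ y → not (inBlock w j y) ∨ (x <F y)) (Pos n)) (Pos n)
  ∧ any (λ x → inBlock w l x ∧ all (λ y → not (inBlock w j y) ∨ (y <F x)) (Pos n)) (Pos n)

monotone : Vec ℕ n → Bool
monotone w =
  all (λ j → all (λ l → not (nested w j l) ∨ (l <ᵇ j)) (oneTo (numBlocks w)))
      (oneTo (numBlocks w))

isMton : Vec ℕ n → Bool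
isMton w = labelsOk w ∧ nonCrossing w ∧ monotone w

vecs : (n b : ℕ) → List (Vec ℕ n)
vecs zero    b = Vec.[] ∷ []
vecs (suc n) b = concatMap (λ x → map (x Vec.∷_) (vecs n b)) (oneTo b)

-- explicit enumeration of NC^(mton)(n) (each element exactly once;
-- labels of an element never exceed n)
NCm : (n : ℕ) → List (Vec ℕ n)
NCm n = filterᵇ isMton (vecs n n)

lastWith : ℕ → Vec ℕ n → Maybe (Fin n)
lastWith k Vec.[] = nothing
lastWith k (x Vec.∷ xs) with lastWith k xs
... | just i  = just (Data.Fin.suc i)
... | nothing = if x ≡ᵇ k then just Data.Fin.zero else nothing

-- the parent p(π,u): delete m = max J(π,u), J = u⁻¹(|π|).  Labels are
-- kept (v(φ(V∖{m})) = u(V)); if {m} was a singleton block it disappears.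
parent : Vec ℕ (suc n) → Vec ℕ n
parent w with lastWith (numBlocks w) w
... | just m  = removeAt w m
... | nothing = removeAt w Data.Fin.zero   -- unreachable (max label is attained)

_==V_ : Vec ℕ n → Vec ℕ n → Bool
v ==V w = does (≡-dec ℕ._≟_ v w)

-- (Z_n)_n, encoded as one family (only values on NC^(mton)(n), n ≥ 1, matter)
Family : Set
Family = (n : ℕ) → Vec ℕ n → ℤ

-- recursive of the second kind with input (α, β; q); the step n-1 → n
-- is written m → suc m with m ≥ 1 (i.e. n ≥ 2).  C_o(ρ,v) is given as
-- { w ∈ C(ρ,v) : Co w }, for a predicate Co on NC^(mton)(n).
RecursiveSecondKind : ℤ → ℤ → ℤ → Family → Set
RecursiveSecondKind α β q Z =
  (m : ℕ) → 1 ≤ m →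
  Σ (Vec ℕ (suc m) → Bool) λ Co →
    ((ρ : Vec ℕ m) → T (isMton ρ) →
       + length (filterᵇ (λ w → (parent w ==V ρ) ∧ Co w) (NCm (suc m)))
         ≡ Z m ρ ℤ.+ q)
    ×
    ((w : Vec ℕ (suc m)) → T (isMton w) →
       Z (suc m) w ≡ Z m (parent w) ℤ.+ (if Co w then α else β))

sumℤ : List ℤ → ℤ
sumℤ = foldr ℤ._+_ (+ 0)

mean : ℤ → ℕ → ℚ
mean s zero    = ℚ.0ℚ
mean s (suc c) = s ℚ./ suc c

E : Family → ℕ → ℚ
E Z n = mean (sumℤ (map (Z n) (NCm n))) (length (NCm n))

-- The top block J = u⁻¹(|π|) of (π, u) ∈ NC^(mton)(n) is an interval: a point between
-- two points of J but outside J would lie in a block nested inside J, and that block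
-- would need a label larger than |π|.  So the point max J removed by the parent map is
-- either a singleton block or directly follows the previous point of J.  Conversely
-- each (ρ, v) ∈ NC^(mton)(n-1) has exactly n+1 children: a new singleton block with the
-- new largest label, inserted at any of the n positions, or a new point added to the
-- top block of ρ directly after its maximum.  Summing the recursion over these children
-- gives (n+1+α-β) Z_{n-1}(ρ) + αq + β(n+1-q); summing over ρ and dividing by
-- |NC^(mton)(n)| = (n+1) |NC^(mton)(n-1)| gives the formula.

module Submission where

open import Defs
open import Data.Nat using (ℕ; suc; _≤_; _∸_)
open import Data.Integer as ℤ using (ℤ; +_)
open import Data.Rational as ℚ using (ℚ)
open import Relation.Binary.PropositionalEquality using (_≡_)

open import Data.Bool using (Bool; true; false; _∧_; _∨_; not; T; T?; if_then_else_)
open import Data.Bool.ListAction using (all; any)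
open import Data.Bool.Properties using (T-∧)
open import Data.Empty using (⊥)
open import Data.Fin as Fin using (Fin; toℕ; punchIn; punchOut; pinch)
import Data.Fin.Properties as Fin
open import Data.Integer using (_+_; _*_; _-_)
import Data.Integer.Properties as ℤ
open import Data.Integer.Tactic.RingSolver using (solve-∀)
open import Algebra.Properties.CommutativeSemigroup ℤ.+-commutativeSemigroup
  using () renaming (interchange to +-interchange)
open import Data.List
  using (List; []; _∷_; _++_; map; length; filterᵇ; allFin; concatMap; cartesianProductWith)
open import Data.List.Properties using (length-map; length-tabulate; length-++; map-cong-local)
open import Data.List.Membership.Propositional using (_∈_; lose; find)
open import Data.List.Membership.Propositional.Properties
  using ( ∈-allFin; ∈-map⁺; ∈-map⁻; ∈-upTo⁺; ∈-upTo⁻; ∈-cartesianProductWith⁺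
        ; ∈-filter⁺; ∈-filter⁻; ∈-concatMap⁺; ∈-concatMap⁻)
open import Data.List.Membership.Propositional.Properties.WithK using (unique∧set⇒bag)
open import Data.List.Relation.Binary.BagAndSetEquality using (∼bag⇒↭)
open import Data.List.Relation.Binary.Disjoint.Propositional using (Disjoint)
open import Data.List.Relation.Binary.Permutation.Propositional using (_↭_; ↭⇒↭ₛ)
import Data.List.Relation.Binary.Permutation.Propositional.Properties as ↭
import Data.List.Relation.Binary.Permutation.Setoid.Properties as Permutationₛ
open import Data.List.Relation.Unary.All as All using (All)
open import Data.List.Relation.Unary.All.Properties using (all⁺; all⁻)
import Data.List.Relation.Unary.All.Properties as All
import Data.List.Relation.Unary.AllPairs as AllPairs
import Data.List.Relation.Unary.AllPairs.Properties as AllPairs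
open import Data.List.Relation.Unary.Any as Any using (Any)
open import Data.List.Relation.Unary.Any.Properties using (any⁺; any⁻)
open import Data.List.Relation.Unary.Unique.Propositional using (Unique)
import Data.List.Relation.Unary.Unique.Propositional.Properties as Unique
open import Data.Maybe using (Maybe; just; nothing)
open import Data.Nat as ℕ using (zero; _<_; _≡ᵇ_; z≤n; s≤s)
open import Data.Nat.Properties as ℕ using (≡ᵇ⇒≡; ≡⇒≡ᵇ; <ᵇ⇒<; <⇒<ᵇ; ≤ᵇ⇒≤; ≤⇒≤ᵇ)
open import Data.Product using (_×_; _,_; proj₁; proj₂; ∃-syntax; uncurry)
import Data.Rational.Properties as ℚ
open import Data.Rational.Unnormalised as ℚᵘ using (mkℚᵘ; *≡*)
import Data.Rational.Unnormalised.Properties as ℚᵘ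
open import Data.Sum using (_⊎_; inj₁; inj₂)
open import Data.Vec as Vec using (Vec; lookup; insertAt; removeAt)
open import Data.Vec.Properties using (≡-dec)
import Data.Vec.Properties as Vec
open import Function using (Equivalence; mk⇔; _∘_; flip; id)
open import Relation.Binary.Definitions using (tri<; tri≈; tri>)
import Relation.Binary.PropositionalEquality as ≡
open import Relation.Binary.PropositionalEquality
  using (_≢_; refl; sym; trans; cong; cong₂; subst; module ≡-Reasoning)
open import Relation.Nullary using (¬_; yes; no; contradiction)

private variable
  A B C : Set
  n : ℕ
  x y : Bool

-- Lists, sums and averages

concatMap-map≡cartesianProductWith : (f : A → B → C) (xs : List A) (ys : List B) →
  concatMap (λ x → map (f x) ys) xs ≡ cartesianProductWith f xs ys
concatMap-map≡cartesianProductWith f []       ys = refl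
concatMap-map≡cartesianProductWith f (x ∷ xs) ys =
  cong (map (f x) ys ++_) (concatMap-map≡cartesianProductWith f xs ys)

filterᵇ-∧ : (p q : A → Bool) (xs : List A) →
            filterᵇ (λ x → p x ∧ q x) xs ≡ filterᵇ q (filterᵇ p xs)
filterᵇ-∧ p q []       = refl
filterᵇ-∧ p q (x ∷ xs) with p x
... | false = filterᵇ-∧ p q xs
... | true with q x
...   | true  = cong (x ∷_) (filterᵇ-∧ p q xs)
...   | false = filterᵇ-∧ p q xs

length-concatMap-const : (g : A → List B) {c : ℕ} → (∀ x → length (g x) ≡ c) → ∀ xs →
                         length (concatMap g xs) ≡ c ℕ.* length xs
length-concatMap-const g {c} |g|≡c []       = sym (ℕ.*-zeroʳ c)
length-concatMap-const g {c} |g|≡c (x ∷ xs) = begin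
  length (g x ++ concatMap g xs)
    ≡⟨ length-++ (g x) ⟩
  length (g x) ℕ.+ length (concatMap g xs)
    ≡⟨ cong₂ ℕ._+_ (|g|≡c x) (length-concatMap-const g |g|≡c xs) ⟩
  c ℕ.+ c ℕ.* length xs
    ≡⟨ ℕ.*-suc c (length xs) ⟨
  c ℕ.* suc (length xs) ∎
  where open ≡-Reasoning

sumMap : (A → ℤ) → List A → ℤ
sumMap f xs = sumℤ (map f xs)

sumMap-↭ : (f : A → ℤ) {xs ys : List A} → xs ↭ ys → sumMap f xs ≡ sumMap f ys
sumMap-↭ f xs↭ys = Permutationₛ.foldr-commMonoid (≡.setoid ℤ) ℤ.+-0-isCommutativeMonoid
                                                  (↭⇒↭ₛ (↭.map⁺ f xs↭ys))

sumMap-cong : {f g : A → ℤ} {xs : List A} → (∀ {x} → x ∈ xs → f x ≡ g x) →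
              sumMap f xs ≡ sumMap g xs
sumMap-cong f≗g = cong sumℤ (map-cong-local (All.tabulate f≗g))

sumMap-++ : (f : A → ℤ) (xs ys : List A) → sumMap f (xs ++ ys) ≡ sumMap f xs + sumMap f ys
sumMap-++ f []       ys = sym (ℤ.+-identityˡ _)
sumMap-++ f (x ∷ xs) ys = trans (cong (_+_ (f x)) (sumMap-++ f xs ys)) (sym (ℤ.+-assoc (f x) _ _))

sumMap-concatMap : (f : B → ℤ) (g : A → List B) (xs : List A) →
                   sumMap f (concatMap g xs) ≡ sumMap (sumMap f ∘ g) xs
sumMap-concatMap f g []       = refl
sumMap-concatMap f g (x ∷ xs) = trans (sumMap-++ f (g x) (concatMap g xs))
                                      (cong (_+_ (sumMap f (g x))) (sumMap-concatMap f g xs))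

sumMap-+ : (f g : A → ℤ) (xs : List A) → sumMap (λ x → f x + g x) xs ≡ sumMap f xs + sumMap g xs
sumMap-+ f g []       = refl
sumMap-+ f g (x ∷ xs) = trans (cong (_+_ (f x + g x)) (sumMap-+ f g xs))
                              (+-interchange (f x) (g x) (sumMap f xs) (sumMap g xs))

sumMap-*ˡ : (a : ℤ) (f : A → ℤ) (xs : List A) → sumMap (λ x → a * f x) xs ≡ a * sumMap f xs
sumMap-*ˡ a f []       = sym (ℤ.*-zeroʳ a)
sumMap-*ˡ a f (x ∷ xs) = trans (cong (_+_ (a * f x)) (sumMap-*ˡ a f xs))
                               (sym (ℤ.*-distribˡ-+ a (f x) (sumMap f xs)))

sumMap-const : (c : ℤ) (xs : List A) → sumMap (λ _ → c) xs ≡ c * + length xs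
sumMap-const c []       = sym (ℤ.*-zeroʳ c)
sumMap-const c (x ∷ xs) = trans (cong (_+_ c) (sumMap-const c xs)) (sym (ℤ.*-suc c (+ length xs)))

sumMap-if : (α β : ℤ) (p : A → Bool) (xs : List A) →
  sumMap (λ x → if p x then α else β) xs
    ≡ α * + length (filterᵇ p xs) + β * (+ length xs - + length (filterᵇ p xs))
sumMap-if α β p []       = sym (cong₂ _+_ (ℤ.*-zeroʳ α) (ℤ.*-zeroʳ β))
sumMap-if α β p (x ∷ xs) with p x
... | true  = trans (cong (_+_ α) (sumMap-if α β p xs))
                    (count-step α β (+ length (filterᵇ p xs)) (+ length xs))
  where
  count-step : ∀ α β C L → α + (α * C + β * (L - C)) ≡ α * (+ 1 + C) + β * ((+ 1 + L) - (+ 1 + C))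
  count-step = solve-∀
... | false = trans (cong (_+_ β) (sumMap-if α β p xs))
                    (skip-step α β (+ length (filterᵇ p xs)) (+ length xs))
  where
  skip-step : ∀ α β C L → β + (α * C + β * (L - C)) ≡ α * C + β * ((+ 1 + L) - C)
  skip-step = solve-∀

mean-affine : ∀ (a b s : ℤ) (k c : ℕ) →
  mean (a * s + b * + suc c) (suc k ℕ.* suc c) ≡ (a ℚ./ suc k) ℚ.* mean s (suc c) ℚ.+ b ℚ./ suc k
mean-affine a b s k c = ℚ.toℚᵘ-injective (begin-equality
  ℚ.toℚᵘ (ℚ.fromℚᵘ (mkℚᵘ (a * s + b * + suc c) (c ℕ.+ k ℕ.* suc c)))
    ≃⟨ ℚ.toℚᵘ-fromℚᵘ _ ⟩
  mkℚᵘ (a * s + b * + suc c) (c ℕ.+ k ℕ.* suc c)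
    ≃⟨ *≡* (cross-multiplied a s b (+ suc k) (+ suc c)) ⟩
  mkℚᵘ a k ℚᵘ.* mkℚᵘ s c ℚᵘ.+ mkℚᵘ b k
    ≃⟨ ℚᵘ.+-cong (ℚᵘ.*-cong (ℚ.toℚᵘ-fromℚᵘ (mkℚᵘ a k)) (ℚ.toℚᵘ-fromℚᵘ (mkℚᵘ s c)))
                  (ℚ.toℚᵘ-fromℚᵘ (mkℚᵘ b k)) ⟨
  ℚ.toℚᵘ (a ℚ./ suc k) ℚᵘ.* ℚ.toℚᵘ (s ℚ./ suc c) ℚᵘ.+ ℚ.toℚᵘ (b ℚ./ suc k)
    ≃⟨ ℚᵘ.+-cong (ℚ.toℚᵘ-homo-* (a ℚ./ suc k) (s ℚ./ suc c)) ℚᵘ.≃-refl ⟨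
  ℚ.toℚᵘ ((a ℚ./ suc k) ℚ.* (s ℚ./ suc c)) ℚᵘ.+ ℚ.toℚᵘ (b ℚ./ suc k)
    ≃⟨ ℚ.toℚᵘ-homo-+ ((a ℚ./ suc k) ℚ.* (s ℚ./ suc c)) (b ℚ./ suc k) ⟨
  ℚ.toℚᵘ ((a ℚ./ suc k) ℚ.* (s ℚ./ suc c) ℚ.+ b ℚ./ suc k) ∎)
  where
  open ℚᵘ.≤-Reasoning
  cross-multiplied : ∀ a s b K C →
    (a * s + b * C) * ((K * C) * K) ≡ ((a * s) * K + b * (K * C)) * (K * C)
  cross-multiplied = solve-∀

-- Positions in vectors

pivot⊎punchIn : (i y : Fin (suc n)) → y ≡ i ⊎ ∃[ y' ] punchIn i y' ≡ y
pivot⊎punchIn i y with y Fin.≟ i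
... | yes y≡i = inj₁ y≡i
... | no  y≢i = inj₂ (punchOut (y≢i ∘ sym) , Fin.punchIn-punchOut (y≢i ∘ sym))

punchIn-cancel-< : ∀ i {a b : Fin n} → punchIn i a Fin.< punchIn i b → a Fin.< b
punchIn-cancel-< i {a} {b} h = Fin.≤∧≢⇒< (Fin.punchIn-cancel-≤ i a b (ℕ.<⇒≤ h))
                                          λ { refl → Fin.<-irrefl refl h }

toℕ-punchIn-below : ∀ i (j : Fin n) → punchIn i j Fin.< i → toℕ (punchIn i j) ≡ toℕ j
toℕ-punchIn-below (Fin.suc i) Fin.zero    _         = refl
toℕ-punchIn-below (Fin.suc i) (Fin.suc j) (s≤s h) = cong suc (toℕ-punchIn-below i j h)

toℕ≤suc-pinch : ∀ (p : Fin n) y → toℕ y ≤ suc (toℕ (pinch p y))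
toℕ≤suc-pinch {suc n} _           Fin.zero    = z≤n
toℕ≤suc-pinch {suc n} Fin.zero    (Fin.suc y) = ℕ.≤-refl
toℕ≤suc-pinch {suc n} (Fin.suc p) (Fin.suc y) = s≤s (toℕ≤suc-pinch p y)

lookup-removeAt : (w : Vec A (suc n)) (i : Fin (suc n)) (j : Fin n) →
                  lookup (removeAt w i) j ≡ lookup w (punchIn i j)
lookup-removeAt w i j = trans (cong (lookup (removeAt w i)) (sym (Fin.punchOut-punchIn i)))
                              (Vec.removeAt-punchOut w (Fin.punchInᵢ≢i i j ∘ sym))

lookup-insertAt-duplicate : (ρ : Vec A (suc n)) (p : Fin (suc n)) (y : Fin (suc (suc n))) →
  lookup (insertAt ρ (Fin.suc p) (lookup ρ p)) y ≡ lookup ρ (pinch p y)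
lookup-insertAt-duplicate (x Vec.∷ ρ) Fin.zero    Fin.zero    = refl
lookup-insertAt-duplicate (x Vec.∷ ρ) Fin.zero    (Fin.suc y) = refl
lookup-insertAt-duplicate {n = suc _} (x Vec.∷ ρ) (Fin.suc p) Fin.zero    = refl
lookup-insertAt-duplicate {n = suc _} (x Vec.∷ ρ) (Fin.suc p) (Fin.suc y) =
  lookup-insertAt-duplicate ρ p y

-- Monotonically ordered non-crossing partitions

NonCrossing : Vec ℕ n → Set
NonCrossing {n} w = (a b c d : Fin n) → a Fin.< b → b Fin.< c → c Fin.< d →
  lookup w a ≡ lookup w c → lookup w b ≡ lookup w d → lookup w a ≡ lookup w b

Nested : Vec ℕ n → ℕ → ℕ → Set
Nested {n} w j l =
  (∃[ x ] lookup w x ≡ l × ∀ y → lookup w y ≡ j → x Fin.< y) ×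
  (∃[ x ] lookup w x ≡ l × ∀ y → lookup w y ≡ j → y Fin.< x)

Monotone : Vec ℕ n → Set
Monotone w = ∀ j l → 1 ≤ j → j ≤ numBlocks w → 1 ≤ l → l ≤ numBlocks w →
  Nested w j l → l < j

record Mton (w : Vec ℕ n) : Set where
  field
    positive    : ∀ i → 1 ≤ lookup w i
    onto        : ∀ j → 1 ≤ j → j ≤ numBlocks w → ∃[ i ] lookup w i ≡ j
    noncrossing : NonCrossing w
    monotonic   : Monotone w

T-∧⁺ : T (x ∧ y) → T x × T y
T-∧⁺ = Equivalence.to T-∧

T-∧⁻ : T x → T y → T (x ∧ y)
T-∧⁻ p q = Equivalence.from T-∧ (p , q)

T-⇒⁺ : T (not x ∨ y) → T x → T y
T-⇒⁺ {true} h _ = h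

T-⇒⁻ : (T x → T y) → T (not x ∨ y)
T-⇒⁻ {true}  f = f _
T-⇒⁻ {false} _ = _

T-not⇒¬T : T (not x) → T x → ⊥
T-not⇒¬T {false} _ ()

¬T⇒T-not : (T x → ⊥) → T (not x)
¬T⇒T-not {true}  ¬t = ¬t _
¬T⇒T-not {false} _  = _

module _ {p : Fin n → Bool} where

  T-allPos⁺ : T (all p (Pos n)) → ∀ i → T (p i)
  T-allPos⁺ h i = All.lookup (all⁺ p _ h) (∈-allFin i)

  T-allPos⁻ : (∀ i → T (p i)) → T (all p (Pos n))
  T-allPos⁻ f = all⁻ p {xs = Pos n} (All.tabulate λ {i} _ → f i)

  T-anyPos⁺ : T (any p (Pos n)) → ∃[ i ] T (p i)
  T-anyPos⁺ h = Any.satisfied (any⁻ p (Pos n) h)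

  T-anyPos⁻ : (i : Fin n) → T (p i) → T (any p (Pos n))
  T-anyPos⁻ i pi = any⁺ p (lose {xs = Pos n} (∈-allFin i) pi)

∈-oneTo : ∀ {j k} → 1 ≤ j → j ≤ k → j ∈ oneTo k
∈-oneTo {suc j} _ j<k = ∈-map⁺ suc (∈-upTo⁺ j<k)

module _ {p : ℕ → Bool} {k : ℕ} where

  T-allOneTo⁺ : T (all p (oneTo k)) → ∀ j → 1 ≤ j → j ≤ k → T (p j)
  T-allOneTo⁺ h j 1≤j j≤k = All.lookup (all⁺ p _ h) (∈-oneTo 1≤j j≤k)

  T-allOneTo⁻ : (∀ j → 1 ≤ j → j ≤ k → T (p j)) → T (all p (oneTo k))
  T-allOneTo⁻ f = all⁻ p {xs = oneTo k} (All.tabulate λ j∈ → oneTo-bounds j∈)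
    where
    oneTo-bounds : ∀ {j} → j ∈ oneTo k → T (p j)
    oneTo-bounds j∈ with ∈-map⁻ suc j∈
    ... | i , i∈ , refl = f (suc i) (s≤s z≤n) (∈-upTo⁻ i∈)

module _ (w : Vec ℕ n) where

  T-nonCrossing⁺ : T (nonCrossing w) → NonCrossing w
  T-nonCrossing⁺ h a b c d a<b b<c c<d ac bd with lookup w a ℕ.≟ lookup w b
  ... | yes ab = ab
  ... | no ¬ab = contradiction crossing
                   (T-not⇒¬T (T-allPos⁺ (T-allPos⁺ (T-allPos⁺ (T-allPos⁺ h a) b) c) d))
    where
    crossing : T ((a <F b) ∧ (b <F c) ∧ (c <F d) ∧ (lookup w a ≡ᵇ lookup w c) ∧ (lookup w b ≡ᵇ lookup w d)
                  ∧ not (lookup w a ≡ᵇ lookup w b))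
    crossing = T-∧⁻ (<⇒<ᵇ a<b) (T-∧⁻ (<⇒<ᵇ b<c) (T-∧⁻ (<⇒<ᵇ c<d)
      (T-∧⁻ (≡⇒≡ᵇ _ _ ac) (T-∧⁻ (≡⇒≡ᵇ _ _ bd) (¬T⇒T-not (¬ab ∘ ≡ᵇ⇒≡ _ _))))))

  T-nonCrossing⁻ : NonCrossing w → T (nonCrossing w)
  T-nonCrossing⁻ nc =
    T-allPos⁻ λ a → T-allPos⁻ λ b → T-allPos⁻ λ c → T-allPos⁻ λ d → ¬T⇒T-not λ t →
    let a<b , t = T-∧⁺ t ; b<c , t = T-∧⁺ t ; c<d , t = T-∧⁺ t
        ac , t = T-∧⁺ t ; bd , ¬ab = T-∧⁺ t
    in T-not⇒¬T ¬ab (≡⇒≡ᵇ _ _ (nc a b c d (<ᵇ⇒< _ _ a<b) (<ᵇ⇒< _ _ b<c) (<ᵇ⇒< _ _ c<d)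
                                          (≡ᵇ⇒≡ _ _ ac) (≡ᵇ⇒≡ _ _ bd)))

  module _ {j : ℕ} {R : Fin n → Bool} where

    T-blockBound⁺ : T (all (λ y → not (inBlock w j y) ∨ R y) (Pos n)) →
                    ∀ y → lookup w y ≡ j → T (R y)
    T-blockBound⁺ h y e = T-⇒⁺ (T-allPos⁺ h y) (≡⇒≡ᵇ _ _ e)

    T-blockBound⁻ : (∀ y → lookup w y ≡ j → T (R y)) →
                    T (all (λ y → not (inBlock w j y) ∨ R y) (Pos n))
    T-blockBound⁻ f = T-allPos⁻ λ y → T-⇒⁻ λ t → f y (≡ᵇ⇒≡ _ _ t)

  T-nested⁺ : ∀ {j l} → T (nested w j l) → Nested w j l
  T-nested⁺ h with T-∧⁺ h
  ... | below , above with T-anyPos⁺ below | T-anyPos⁺ above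
  ... | x , hx | x' , hx' with T-∧⁺ hx | T-∧⁺ hx'
  ... | xl , xb | x'l , x'b =
    (x  , ≡ᵇ⇒≡ _ _ xl  , λ y e → <ᵇ⇒< _ _ (T-blockBound⁺ xb y e)) ,
    (x' , ≡ᵇ⇒≡ _ _ x'l , λ y e → <ᵇ⇒< _ _ (T-blockBound⁺ x'b y e))

  T-nested⁻ : ∀ {j l} → Nested w j l → T (nested w j l)
  T-nested⁻ ((x , xl , xb) , (x' , x'l , x'b)) =
    T-∧⁻ (T-anyPos⁻ x  (T-∧⁻ (≡⇒≡ᵇ _ _ xl)  (T-blockBound⁻ λ y e → <⇒<ᵇ (xb y e))))
       (T-anyPos⁻ x' (T-∧⁻ (≡⇒≡ᵇ _ _ x'l) (T-blockBound⁻ λ y e → <⇒<ᵇ (x'b y e))))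

  T-monotone⁺ : T (monotone w) → Monotone w
  T-monotone⁺ h j l 1≤j j≤k 1≤l l≤k N =
    <ᵇ⇒< l j (T-⇒⁺ (T-allOneTo⁺ (T-allOneTo⁺ h j 1≤j j≤k) l 1≤l l≤k) (T-nested⁻ N))

  T-monotone⁻ : Monotone w → T (monotone w)
  T-monotone⁻ mono = T-allOneTo⁻ λ j 1≤j j≤k → T-allOneTo⁻ λ l 1≤l l≤k →
    T-⇒⁻ λ N → <⇒<ᵇ (mono j l 1≤j j≤k 1≤l l≤k (T-nested⁺ N))

  isMton⇒Mton : T (isMton w) → Mton w
  isMton⇒Mton h with T-∧⁺ h
  ... | labels , rest with T-∧⁺ labels | T-∧⁺ rest
  ... | pos , onto | nc , mono = record
    { positive    = λ i → ≤ᵇ⇒≤ 1 _ (T-allPos⁺ pos i)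
    ; onto        = λ j 1≤j j≤k → let i , e = T-anyPos⁺ (T-allOneTo⁺ onto j 1≤j j≤k)
                                   in i , ≡ᵇ⇒≡ _ _ e
    ; noncrossing = T-nonCrossing⁺ nc
    ; monotonic   = T-monotone⁺ mono
    }

  Mton⇒isMton : Mton w → T (isMton w)
  Mton⇒isMton M =
    T-∧⁻ (T-∧⁻ (T-allPos⁻ λ i → ≤⇒≤ᵇ (positive i))
               (T-allOneTo⁻ λ j 1≤j j≤k → let i , e = onto j 1≤j j≤k
                                          in T-anyPos⁻ i (≡⇒≡ᵇ _ _ e)))
         (T-∧⁻ (T-nonCrossing⁻ noncrossing) (T-monotone⁻ monotonic))
    where open Mton M

lookup≤numBlocks : (w : Vec ℕ n) (i : Fin n) → lookup w i ≤ numBlocks w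
lookup≤numBlocks (x Vec.∷ w) Fin.zero    = ℕ.m≤m⊔n x (numBlocks w)
lookup≤numBlocks (x Vec.∷ w) (Fin.suc i) =
  ℕ.≤-trans (lookup≤numBlocks w i) (ℕ.m≤n⊔m x (numBlocks w))

numBlocks-least : (w : Vec ℕ n) {b : ℕ} → (∀ i → lookup w i ≤ b) → numBlocks w ≤ b
numBlocks-least Vec.[]       _     = z≤n
numBlocks-least (x Vec.∷ w) x,w≤b =
  ℕ.⊔-lub (x,w≤b Fin.zero) (numBlocks-least w (x,w≤b ∘ Fin.suc))

numBlocks-attained : (w : Vec ℕ (suc n)) → ∃[ i ] lookup w i ≡ numBlocks w
numBlocks-attained {zero}  (x Vec.∷ Vec.[]) = Fin.zero , sym (ℕ.⊔-identityʳ x)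
numBlocks-attained {suc n} (x Vec.∷ w) with ℕ.⊔-sel x (numBlocks w)
... | inj₁ x-wins = Fin.zero , sym x-wins
... | inj₂ w-wins = let i , e = numBlocks-attained w in Fin.suc i , trans e (sym w-wins)

numBlocks≤length : (w : Vec ℕ n) → Mton w → numBlocks w ≤ n
numBlocks≤length w M = Fin.injective⇒≤ position-injective
  where
  open Mton M
  position : Fin (numBlocks w) → Fin _
  position j = proj₁ (onto (suc (toℕ j)) (s≤s z≤n) (Fin.toℕ<n j))
  position-injective : ∀ {i j} → position i ≡ position j → i ≡ j
  position-injective {i} {j} same = Fin.toℕ-injective (ℕ.suc-injective (begin
    suc (toℕ i)           ≡⟨ proj₂ (onto _ (s≤s z≤n) (Fin.toℕ<n i)) ⟨
    lookup w (position i) ≡⟨ cong (lookup w) same ⟩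
    lookup w (position j) ≡⟨ proj₂ (onto _ (s≤s z≤n) (Fin.toℕ<n j)) ⟩
    suc (toℕ j)           ∎))
    where open ≡-Reasoning

vecs-suc : ∀ n b → vecs (suc n) b ≡ cartesianProductWith Vec._∷_ (oneTo b) (vecs n b)
vecs-suc n b = concatMap-map≡cartesianProductWith Vec._∷_ (oneTo b) (vecs n b)

∈-vecs : ∀ {b} (v : Vec ℕ n) → (∀ i → 1 ≤ lookup v i × lookup v i ≤ b) → v ∈ vecs n b
∈-vecs Vec.[]      _ = Any.here refl
∈-vecs {suc n} {b} (x Vec.∷ v) inRange = subst (_ ∈_) (sym (vecs-suc n b))
  (∈-cartesianProductWith⁺ Vec._∷_ (uncurry ∈-oneTo (inRange Fin.zero))
                                    (∈-vecs v (inRange ∘ Fin.suc)))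

oneTo-unique : ∀ k → Unique (oneTo k)
oneTo-unique k = Unique.map⁺ ℕ.suc-injective (Unique.upTo⁺ k)

vecs-unique : ∀ n b → Unique (vecs n b)
vecs-unique zero    b = All.[] AllPairs.∷ AllPairs.[]
vecs-unique (suc n) b = subst Unique (sym (vecs-suc n b))
  (Unique.cartesianProductWith⁺ Vec._∷_ Vec.∷-injective (oneTo-unique b) (vecs-unique n b))

NCm-unique : ∀ n → Unique (NCm n)
NCm-unique n = Unique.filter⁺ _ (vecs-unique n n)

∈-NCm⁺ : (w : Vec ℕ n) → Mton w → w ∈ NCm n
∈-NCm⁺ w M = ∈-filter⁺ (T? ∘ isMton) (∈-vecs w in-range) (Mton⇒isMton w M)
  where
  open Mton M
  in-range : ∀ i → 1 ≤ lookup w i × lookup w i ≤ _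
  in-range i = positive i , ℕ.≤-trans (lookup≤numBlocks w i) (numBlocks≤length w M)

∈-NCm⁻ : (w : Vec ℕ n) → w ∈ NCm n → Mton w
∈-NCm⁻ {n} w w∈ = isMton⇒Mton w (proj₂ (∈-filter⁻ (T? ∘ isMton) {xs = vecs n n} w∈))

-- Nesting

Nested⇒≢ : (w : Vec ℕ n) {j l : ℕ} → Nested w j l → l ≢ j
Nested⇒≢ w ((x , wx , x<block) , _) refl = Fin.<-irrefl refl (x<block x wx)

module Reindex {N M : ℕ} (u : Vec ℕ N) (v : Vec ℕ M) (g : Fin M → Fin N)
  (v≗u∘g : ∀ y → lookup v y ≡ lookup u (g y))
  (g-mono : ∀ {a b} → a Fin.≤ b → g a Fin.≤ g b) where

  private
    strict : ∀ {a b} → a Fin.< b → g a ≢ g b → g a Fin.< g b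
    strict a<b = Fin.≤∧≢⇒< (g-mono (ℕ.<⇒≤ a<b))

    same : ∀ {a b} → g a ≡ g b → lookup v a ≡ lookup v b
    same {a} {b} e = trans (v≗u∘g a) (trans (cong (lookup u) e) (sym (v≗u∘g b)))

    relabel : ∀ {a b} → lookup v a ≡ lookup v b → lookup u (g a) ≡ lookup u (g b)
    relabel {a} {b} e = trans (sym (v≗u∘g a)) (trans e (v≗u∘g b))

  NonCrossing-reindex : NonCrossing u → NonCrossing v
  NonCrossing-reindex nc a b c d a<b b<c c<d ac bd with g a Fin.≟ g b | g b Fin.≟ g c | g c Fin.≟ g d
  ... | yes ga≡gb | _ | _ = same ga≡gb
  ... | no _ | yes gb≡gc | _ = trans ac (sym (same gb≡gc))
  ... | no _ | no _ | yes gc≡gd = trans ac (trans (same gc≡gd) (sym bd))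
  ... | no ga≢gb | no gb≢gc | no gc≢gd = trans (v≗u∘g a) (trans
        (nc (g a) (g b) (g c) (g d) (strict a<b ga≢gb) (strict b<c gb≢gc) (strict c<d gc≢gd)
            (relabel ac) (relabel bd))
        (sym (v≗u∘g b)))

  Nested-reindex : ∀ {j l} → (∀ y' → lookup u y' ≡ j → ∃[ y ] g y ≡ y') →
                   Nested v j l → Nested u j l
  Nested-reindex {j} {l} j-covered N@((x , vx , x<block) , (x' , vx' , block<x')) =
    (g x , trans (sym (v≗u∘g x)) vx , below) , (g x' , trans (sym (v≗u∘g x')) vx' , above)
    where
    separated : ∀ {z y'} → lookup v z ≡ l → lookup u y' ≡ j → g z ≢ y'
    separated {z} vz uy' refl = Nested⇒≢ v N (trans (sym vz) (trans (v≗u∘g z) uy'))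
    below : ∀ y' → lookup u y' ≡ j → g x Fin.< y'
    below y' uy' with j-covered y' uy'
    ... | y , refl = strict (x<block y (trans (v≗u∘g y) uy')) (separated vx uy')
    above : ∀ y' → lookup u y' ≡ j → y' Fin.< g x'
    above y' uy' with j-covered y' uy'
    ... | y , refl = strict (block<x' y (trans (v≗u∘g y) uy')) (separated vx' uy' ∘ sym)

  module _ (g-onto : ∀ y' → ∃[ y ] g y ≡ y') where

    numBlocks-reindex : numBlocks v ≡ numBlocks u
    numBlocks-reindex = ℕ.≤-antisym
      (numBlocks-least v λ y → subst (_≤ numBlocks u) (sym (v≗u∘g y)) (lookup≤numBlocks u (g y)))
      (numBlocks-least u λ y' → let y , gy≡y' = g-onto y' in
        subst (_≤ numBlocks v) (trans (v≗u∘g y) (cong (lookup u) gy≡y')) (lookup≤numBlocks v y))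

    Mton-reindex : Mton u → Mton v
    Mton-reindex M = record
      { positive    = λ y → subst (1 ≤_) (sym (v≗u∘g y)) (positive (g y))
      ; onto        = λ j 1≤j j≤k → let y' , uy' = onto j 1≤j (subst (j ≤_) numBlocks-reindex j≤k)
                                        y , gy≡y' = g-onto y'
                                    in y , trans (v≗u∘g y) (trans (cong (lookup u) gy≡y') uy')
      ; noncrossing = NonCrossing-reindex noncrossing
      ; monotonic   = λ j l 1≤j j≤k 1≤l l≤k N →
          monotonic j l 1≤j (subst (j ≤_) numBlocks-reindex j≤k) 1≤l (subst (l ≤_) numBlocks-reindex l≤k)
                    (Nested-reindex (λ y' _ → g-onto y') N)
      }
      where open Mton M

nested-between : (w : Vec ℕ n) → NonCrossing w → ∀ {a t b l} → a Fin.< t → t Fin.< b →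
  lookup w a ≡ l → lookup w b ≡ l → lookup w t ≢ l → Nested w (lookup w t) l
nested-between w nc {a} {t} {b} a<t t<b wa wb wt≢l = (a , wa , below) , (b , wb , above)
  where
  below : ∀ y → lookup w y ≡ lookup w t → a Fin.< y
  below y wy≡wt with Fin.<-cmp y a
  ... | tri< y<a _ _ =
    contradiction (trans (sym wy≡wt) (trans (nc y a t b y<a a<t t<b wy≡wt (trans wa (sym wb))) wa)) wt≢l
  ... | tri≈ _ refl _ = contradiction (trans (sym wy≡wt) wa) wt≢l
  ... | tri> _ _ a<y = a<y
  above : ∀ y → lookup w y ≡ lookup w t → y Fin.< b
  above y wy≡wt with Fin.<-cmp y b
  ... | tri< y<b _ _ = y<b
  ... | tri≈ _ refl _ = contradiction (trans (sym wy≡wt) wb) wt≢l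
  ... | tri> _ _ b<y =
    contradiction (sym (nc a t b y a<t t<b b<y (trans wa (sym wb)) (sym wy≡wt))) (wt≢l ∘ flip trans wa)

top-block-interval : (w : Vec ℕ n) → Mton w → ∀ {a t b} → a Fin.< t → t Fin.< b →
  lookup w a ≡ numBlocks w → lookup w b ≡ numBlocks w → lookup w t ≡ numBlocks w
top-block-interval w M {a} {t} a<t t<b wa wb with lookup w t ℕ.≟ numBlocks w
... | yes wt≡K = wt≡K
... | no  wt≢K = contradiction (lookup≤numBlocks w t) (ℕ.<⇒≱ (monotonic (lookup w t) (numBlocks w)
      (positive t) (lookup≤numBlocks w t) (subst (1 ≤_) wa (positive a)) ℕ.≤-refl
      (nested-between w noncrossing a<t t<b wa wb wt≢K)))
  where open Mton M

-- The parent map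

LastPos : Vec ℕ n → ℕ → Fin n → Set
LastPos w k m = lookup w m ≡ k × (∀ y → lookup w y ≡ k → y Fin.≤ m)

data LastWith (k : ℕ) (w : Vec ℕ n) : Maybe (Fin n) → Set where
  absent : (∀ y → lookup w y ≢ k) → LastWith k w nothing
  last   : ∀ {m} → LastPos w k m → LastWith k w (just m)

lastWith-view : (k : ℕ) (w : Vec ℕ n) → LastWith k w (lastWith k w)
lastWith-view k Vec.[] = absent λ ()
lastWith-view k (x Vec.∷ w) with lastWith k w | lastWith-view k w
... | just m  | last (wm , f) = last (wm , λ { Fin.zero _ → z≤n ; (Fin.suc y) e → s≤s (f y e) })
... | nothing | absent f with x ≡ᵇ k in eq
...   | true  = last (≡ᵇ⇒≡ x k (subst T (sym eq) _) ,
                      λ { Fin.zero _ → z≤n ; (Fin.suc y) e → contradiction e (f y) })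
...   | false = absent λ { Fin.zero e → subst T eq (≡⇒≡ᵇ x k e) ; (Fin.suc y) → f y }

LastPos-unique : (w : Vec ℕ n) {k : ℕ} {m m' : Fin n} → LastPos w k m → LastPos w k m' → m ≡ m'
LastPos-unique w (wm , f) (wm' , f') = Fin.≤-antisym (f' _ wm) (f _ wm')

lastWith-complete : (w : Vec ℕ n) {k : ℕ} {m : Fin n} → LastPos w k m → lastWith k w ≡ just m
lastWith-complete w {k} L with lastWith k w | lastWith-view k w
... | nothing | absent f = contradiction (proj₁ L) (f _)
... | just m' | last L'  = cong just (LastPos-unique w L' L)

lastTop : (w : Vec ℕ (suc n)) → ∃[ m ] LastPos w (numBlocks w) m
lastTop w with lastWith (numBlocks w) w | lastWith-view (numBlocks w) w
... | nothing | absent f = let i , e = numBlocks-attained w in contradiction e (f i)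
... | just m  | last L   = m , L

parent≡removeAt : (w : Vec ℕ (suc n)) {m : Fin (suc n)} → LastPos w (numBlocks w) m →
                  parent w ≡ removeAt w m
parent≡removeAt w L with lastWith (numBlocks w) w | lastWith-complete w L
... | just _ | refl = refl

module RemoveTop (w : Vec ℕ (suc (suc n))) (m : Fin (suc (suc n)))
                 (wm≡K : lookup w m ≡ numBlocks w) where

  K : ℕ
  K = numBlocks w

  ρ : Vec ℕ (suc n)
  ρ = removeAt w m

  ρ≗w∘punchIn : ∀ y → lookup ρ y ≡ lookup w (punchIn m y)
  ρ≗w∘punchIn = lookup-removeAt w m

  survives : ∀ {y} → lookup w y ≢ K → ∃[ y' ] punchIn m y' ≡ y
  survives {y} wy≢K with pivot⊎punchIn m y
  ... | inj₁ refl = contradiction wm≡K wy≢K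
  ... | inj₂ y'   = y'

  label-survives : ∀ {y} → lookup w y ≢ K → ∃[ y' ] lookup ρ y' ≡ lookup w y
  label-survives wy≢K with survives wy≢K
  ... | y' , refl = y' , ρ≗w∘punchIn y'

  numBlocks-removeAt≤ : numBlocks ρ ≤ K
  numBlocks-removeAt≤ = numBlocks-least ρ λ y →
    subst (_≤ K) (sym (ρ≗w∘punchIn y)) (lookup≤numBlocks w (punchIn m y))

  K≤1+numBlocks-removeAt : Mton w → K ≤ suc (numBlocks ρ)
  K≤1+numBlocks-removeAt M = ℕ.≮⇒≥ λ 1+k<K →
    let y , wy≡1+k = onto (suc (numBlocks ρ)) (s≤s z≤n) (ℕ.<⇒≤ 1+k<K)
        y' , ρy'≡wy = label-survives (ℕ.<⇒≢ (subst (_< K) (sym wy≡1+k) 1+k<K))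
    in ℕ.1+n≰n (subst (_≤ numBlocks ρ) (trans ρy'≡wy wy≡1+k) (lookup≤numBlocks ρ y'))
    where open Mton M

  Mton-removeAt : Mton w → Mton ρ
  Mton-removeAt M = record
    { positive    = λ y → subst (1 ≤_) (sym (ρ≗w∘punchIn y)) (positive (punchIn m y))
    ; onto        = onto′
    ; noncrossing = Reindex.NonCrossing-reindex w ρ (punchIn m) ρ≗w∘punchIn
                      (Fin.punchIn-mono-≤ m _ _) noncrossing
    ; monotonic   = monotonic′
    }
    where
    open Mton M
    below-top : ∀ {j} → j ≤ numBlocks ρ → j ≢ numBlocks ρ → j < K
    below-top j≤k j≢k = ℕ.<-≤-trans (ℕ.≤∧≢⇒< j≤k j≢k) numBlocks-removeAt≤
    onto′ : ∀ j → 1 ≤ j → j ≤ numBlocks ρ → ∃[ y ] lookup ρ y ≡ j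
    onto′ j 1≤j j≤k with j ℕ.≟ numBlocks ρ
    ... | yes refl = numBlocks-attained ρ
    ... | no  j≢k  = let j<K = below-top j≤k j≢k
                         y , wy≡j = onto j 1≤j (ℕ.<⇒≤ j<K)
                         y' , ρy'≡wy = label-survives (ℕ.<⇒≢ (subst (_< K) (sym wy≡j) j<K))
                     in y' , trans ρy'≡wy wy≡j
    monotonic′ : Monotone ρ
    monotonic′ j l 1≤j j≤k 1≤l l≤k N with j ℕ.≟ numBlocks ρ
    ... | yes refl = ℕ.≤∧≢⇒< l≤k (Nested⇒≢ ρ N)
    ... | no  j≢k  = let j<K = below-top j≤k j≢k in
      monotonic j l 1≤j (ℕ.<⇒≤ j<K) 1≤l (ℕ.≤-trans l≤k numBlocks-removeAt≤)
        (Reindex.Nested-reindex w ρ (punchIn m) ρ≗w∘punchIn (Fin.punchIn-mono-≤ m _ _)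
          (λ y wy≡j → survives (ℕ.<⇒≢ (subst (_< K) (sym wy≡j) j<K))) N)

Mton-parent : (w : Vec ℕ (suc (suc n))) → Mton w → Mton (parent w)
Mton-parent w M = let m , L = lastTop w in
  subst Mton (sym (parent≡removeAt w L)) (RemoveTop.Mton-removeAt w m (proj₁ L) M)

-- Children

newBlockChild : Vec ℕ n → Fin (suc n) → Vec ℕ (suc n)
newBlockChild ρ i = insertAt ρ i (suc (numBlocks ρ))

module NewBlock (ρ : Vec ℕ n) (i : Fin (suc n)) where

  private
    K : ℕ
    K = numBlocks ρ
    w : Vec ℕ (suc n)
    w = newBlockChild ρ i

  at-pivot : lookup w i ≡ suc K
  at-pivot = Vec.insertAt-lookup ρ i (suc K)

  at-punchIn : ∀ y → lookup w (punchIn i y) ≡ lookup ρ y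
  at-punchIn = Vec.insertAt-punchIn ρ i (suc K)

  new-label-only-at-pivot : ∀ {y} → lookup w y ≡ suc K → y ≡ i
  new-label-only-at-pivot {y} wy≡1+K with pivot⊎punchIn i y
  ... | inj₁ y≡i        = y≡i
  ... | inj₂ (y' , refl) = contradiction (subst (_≤ K) (trans (sym (at-punchIn y')) wy≡1+K)
                                                (lookup≤numBlocks ρ y')) ℕ.1+n≰n

  old-label : ∀ {y} → lookup w y ≢ suc K → ∃[ y' ] punchIn i y' ≡ y
  old-label {y} wy≢1+K with pivot⊎punchIn i y
  ... | inj₁ refl = contradiction at-pivot wy≢1+K
  ... | inj₂ y'   = y'

  lookup≤1+K : ∀ y → lookup w y ≤ suc K
  lookup≤1+K y with pivot⊎punchIn i y
  ... | inj₁ refl         = ℕ.≤-reflexive at-pivot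
  ... | inj₂ (y' , refl) =
    subst (_≤ suc K) (sym (at-punchIn y')) (ℕ.m≤n⇒m≤1+n (lookup≤numBlocks ρ y'))

  numBlocks-newBlock : numBlocks w ≡ suc K
  numBlocks-newBlock = ℕ.≤-antisym (numBlocks-least w lookup≤1+K)
                                   (subst (_≤ numBlocks w) at-pivot (lookup≤numBlocks w i))

  parent-newBlock : parent w ≡ ρ
  parent-newBlock = trans (parent≡removeAt w last-at-pivot) (Vec.removeAt-insertAt ρ i (suc K))
    where
    last-at-pivot : LastPos w (numBlocks w) i
    last-at-pivot = trans at-pivot (sym numBlocks-newBlock) ,
      λ y wy≡ → ℕ.≤-reflexive (cong toℕ (new-label-only-at-pivot (trans wy≡ numBlocks-newBlock)))

  module _ (M : Mton ρ) where

    open Mton M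

    positive-newBlock : ∀ y → 1 ≤ lookup w y
    positive-newBlock y with pivot⊎punchIn i y
    ... | inj₁ refl         = subst (1 ≤_) (sym at-pivot) (s≤s z≤n)
    ... | inj₂ (y' , refl) = subst (1 ≤_) (sym (at-punchIn y')) (positive y')

    onto-newBlock : ∀ j → 1 ≤ j → j ≤ numBlocks w → ∃[ y ] lookup w y ≡ j
    onto-newBlock j 1≤j j≤k with j ℕ.≟ suc K
    ... | yes refl = i , at-pivot
    ... | no j≢1+K =
      let j≤K = ℕ.s≤s⁻¹ (ℕ.≤∧≢⇒< (subst (j ≤_) numBlocks-newBlock j≤k) j≢1+K)
          y' , ρy'≡j = onto j 1≤j j≤K
      in punchIn i y' , trans (at-punchIn y') ρy'≡j

    noncrossing-newBlock : NonCrossing w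
    noncrossing-newBlock a b c d a<b b<c c<d ac bd with lookup w a ℕ.≟ suc K | lookup w b ℕ.≟ suc K
    ... | yes wa≡1+K | _ = contradiction (trans (new-label-only-at-pivot wa≡1+K)
                                                (sym (new-label-only-at-pivot (trans (sym ac) wa≡1+K))))
                                         (Fin.<⇒≢ (ℕ.<-trans a<b b<c))
    ... | no _ | yes wb≡1+K = contradiction (trans (new-label-only-at-pivot wb≡1+K)
                                                   (sym (new-label-only-at-pivot (trans (sym bd) wb≡1+K))))
                                            (Fin.<⇒≢ (ℕ.<-trans b<c c<d))
    ... | no wa≢1+K | no wb≢1+K
      with old-label wa≢1+K | old-label wb≢1+K
         | old-label (wa≢1+K ∘ trans ac) | old-label (wb≢1+K ∘ trans bd)
    ... | a' , refl | b' , refl | c' , refl | d' , refl =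
      trans (at-punchIn a') (trans
        (noncrossing a' b' c' d' (punchIn-cancel-< i a<b) (punchIn-cancel-< i b<c) (punchIn-cancel-< i c<d)
          (trans (sym (at-punchIn a')) (trans ac (at-punchIn c')))
          (trans (sym (at-punchIn b')) (trans bd (at-punchIn d'))))
        (sym (at-punchIn b')))

    nested-newBlock⇒nested : ∀ {j l} → l ≢ suc K → Nested w j l → Nested ρ j l
    nested-newBlock⇒nested l≢1+K ((x , wx , x<block) , (x' , wx' , block<x'))
      with old-label (l≢1+K ∘ trans (sym wx)) | old-label (l≢1+K ∘ trans (sym wx'))
    ... | z , refl | z' , refl =
      (z  , trans (sym (at-punchIn z))  wx  , λ y ρy≡j → punchIn-cancel-< i (x<block  _ (relabel y ρy≡j))) ,
      (z' , trans (sym (at-punchIn z')) wx' , λ y ρy≡j → punchIn-cancel-< i (block<x' _ (relabel y ρy≡j)))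
      where
      relabel : ∀ y {j} → lookup ρ y ≡ j → lookup w (punchIn i y) ≡ j
      relabel y = trans (at-punchIn y)

    monotonic-newBlock : Monotone w
    monotonic-newBlock j l 1≤j j≤k 1≤l l≤k N with j ℕ.≟ numBlocks w | l ℕ.≟ suc K
    ... | yes refl | _ = ℕ.≤∧≢⇒< l≤k (Nested⇒≢ w N)
    ... | no _ | yes refl =
      let (x , wx , x<block) , (x' , wx' , block<x') = N
          y , wy≡j = onto-newBlock j 1≤j j≤k
      in contradiction (subst (Fin._< y) (new-label-only-at-pivot wx) (x<block y wy≡j))
                       (Fin.<-asym (subst (y Fin.<_) (new-label-only-at-pivot wx') (block<x' y wy≡j)))
    ... | no j≢k | no l≢1+K =
      monotonic j l 1≤j (below-top j≤k j≢k) 1≤l (below-top l≤k (l≢1+K ∘ flip trans numBlocks-newBlock))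
        (nested-newBlock⇒nested l≢1+K N)
      where
      below-top : ∀ {x} → x ≤ numBlocks w → x ≢ numBlocks w → x ≤ K
      below-top x≤k x≢k = ℕ.s≤s⁻¹ (subst (_ <_) numBlocks-newBlock (ℕ.≤∧≢⇒< x≤k x≢k))

    Mton-newBlock : Mton w
    Mton-newBlock = record
      { positive    = positive-newBlock
      ; onto        = onto-newBlock
      ; noncrossing = noncrossing-newBlock
      ; monotonic   = monotonic-newBlock
      }

extendTopChild : Vec ℕ (suc n) → Vec ℕ (suc (suc n))
extendTopChild ρ = insertAt ρ (Fin.suc (proj₁ (lastTop ρ))) (numBlocks ρ)

module ExtendTop (ρ : Vec ℕ (suc n)) where

  private
    K : ℕ
    K = numBlocks ρ
    p : Fin (suc n)
    p = proj₁ (lastTop ρ)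
    last-p : LastPos ρ K p
    last-p = proj₂ (lastTop ρ)
    w : Vec ℕ (suc (suc n))
    w = extendTopChild ρ

  w≗ρ∘pinch : ∀ y → lookup w y ≡ lookup ρ (pinch p y)
  w≗ρ∘pinch y = subst (λ x → lookup (insertAt ρ (Fin.suc p) x) y ≡ lookup ρ (pinch p y))
                      (proj₁ last-p) (lookup-insertAt-duplicate ρ p y)

  pinch-onto : ∀ y' → ∃[ y ] pinch p y ≡ y'
  pinch-onto y' = let y , pinch≡ = Fin.pinch-surjective p y' in y , pinch≡ refl

  open Reindex ρ w (pinch p) w≗ρ∘pinch (Fin.pinch-mono-≤ p)

  parent-extendTop : parent w ≡ ρ
  parent-extendTop = trans (parent≡removeAt w last-after-p) (Vec.removeAt-insertAt ρ (Fin.suc p) K)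
    where
    K≡ : numBlocks w ≡ K
    K≡ = numBlocks-reindex pinch-onto
    last-after-p : LastPos w (numBlocks w) (Fin.suc p)
    last-after-p = trans (Vec.insertAt-lookup ρ (Fin.suc p) K) (sym K≡) , λ y wy≡ →
      ℕ.≤-trans (toℕ≤suc-pinch p y)
                (s≤s (proj₂ last-p (pinch p y) (trans (sym (w≗ρ∘pinch y)) (trans wy≡ K≡))))

  Mton-extendTop : Mton ρ → Mton w
  Mton-extendTop = Mton-reindex pinch-onto

children : Vec ℕ (suc n) → List (Vec ℕ (suc (suc n)))
children ρ = extendTopChild ρ ∷ map (newBlockChild ρ) (allFin _)

∈-children⁻ : (ρ : Vec ℕ (suc n)) {w : Vec ℕ (suc (suc n))} → w ∈ children ρ →
              w ≡ extendTopChild ρ ⊎ ∃[ i ] w ≡ newBlockChild ρ i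
∈-children⁻ ρ (Any.here w≡)  = inj₁ w≡
∈-children⁻ ρ (Any.there w∈) =
  let i , _ , w≡ = ∈-map⁻ (newBlockChild ρ) {xs = allFin _} w∈ in inj₂ (i , w≡)

parent-children : (ρ : Vec ℕ (suc n)) {w : Vec ℕ (suc (suc n))} → w ∈ children ρ → parent w ≡ ρ
parent-children ρ w∈ with ∈-children⁻ ρ w∈
... | inj₁ refl       = ExtendTop.parent-extendTop ρ
... | inj₂ (i , refl) = NewBlock.parent-newBlock ρ i

Mton-children : (ρ : Vec ℕ (suc n)) → Mton ρ →
                {w : Vec ℕ (suc (suc n))} → w ∈ children ρ → Mton w
Mton-children ρ M w∈ with ∈-children⁻ ρ w∈
... | inj₁ refl       = ExtendTop.Mton-extendTop ρ M
... | inj₂ (i , refl) = NewBlock.Mton-newBlock ρ i M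

length-children : (ρ : Vec ℕ (suc n)) → length (children ρ) ≡ suc (suc (suc n))
length-children ρ = cong suc (trans (length-map (newBlockChild ρ) (allFin _)) (length-tabulate id))

children-unique : (ρ : Vec ℕ (suc n)) → Unique (children ρ)
children-unique ρ =
  All.tabulate extendTop∉newBlocks AllPairs.∷ Unique.map⁺ newBlock-injective (Unique.allFin⁺ _)
  where
  newBlock-injective : ∀ {i i'} → newBlockChild ρ i ≡ newBlockChild ρ i' → i ≡ i'
  newBlock-injective {i} {i'} e = NewBlock.new-label-only-at-pivot ρ i'
                                    (trans (cong (flip lookup i) (sym e)) (NewBlock.at-pivot ρ i))
  extendTop∉newBlocks : ∀ {v} → v ∈ map (newBlockChild ρ) (allFin _) → extendTopChild ρ ≢ v
  extendTop∉newBlocks v∈ refl = let i , _ , e = ∈-map⁻ (newBlockChild ρ) {xs = allFin _} v∈ in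
    ℕ.1+n≰n (subst (_≤ numBlocks ρ) (trans (cong (flip lookup i) e) (NewBlock.at-pivot ρ i))
      (subst (_≤ numBlocks ρ) (sym (ExtendTop.w≗ρ∘pinch ρ i)) (lookup≤numBlocks ρ _)))

module LastTopRemoved (w : Vec ℕ (suc (suc n))) (M : Mton w) where

  m : Fin (suc (suc n))
  m = proj₁ (lastTop w)

  last-m : LastPos w (numBlocks w) m
  last-m = proj₂ (lastTop w)

  open RemoveTop w m (proj₁ last-m)
  open Mton M

  w≡insertAt : w ≡ insertAt ρ m K
  w≡insertAt = trans (sym (Vec.insertAt-removeAt w m)) (cong (insertAt ρ m) (proj₁ last-m))

  new-singleton : (∀ y → lookup ρ y ≢ K) → w ≡ newBlockChild ρ m
  new-singleton K∉ρ = trans w≡insertAt (cong (insertAt ρ m) K≡1+k)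
    where
    k<K : numBlocks ρ < K
    k<K = let y , ρy≡k = numBlocks-attained ρ in
      subst (_< K) ρy≡k
            (ℕ.≤∧≢⇒< (subst (_≤ K) (sym (ρ≗w∘punchIn y)) (lookup≤numBlocks w _)) (K∉ρ y))
    K≡1+k : K ≡ suc (numBlocks ρ)
    K≡1+k = ℕ.≤-antisym (K≤1+numBlocks-removeAt M) k<K

  extended : ∀ {p} → LastPos ρ K p → w ≡ extendTopChild ρ
  extended {p} last-p = trans w≡insertAt (cong₂ (insertAt ρ) m≡1+p (sym k≡K))
    where
    k≡K : numBlocks ρ ≡ K
    k≡K = ℕ.≤-antisym numBlocks-removeAt≤
                      (subst (_≤ numBlocks ρ) (proj₁ last-p) (lookup≤numBlocks ρ p))
    lastTopρ≡p : p ≡ proj₁ (lastTop ρ)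
    lastTopρ≡p = LastPos-unique ρ (subst (λ k → LastPos ρ k p) (sym k≡K) last-p) (proj₂ (lastTop ρ))
    p* : Fin (suc (suc n))
    p* = punchIn m p
    wp*≡K : lookup w p* ≡ K
    wp*≡K = trans (sym (ρ≗w∘punchIn p)) (proj₁ last-p)
    p*<m : p* Fin.< m
    p*<m = Fin.≤∧≢⇒< (proj₂ last-m p* wp*≡K) (Fin.punchInᵢ≢i m p)
    -- the top block is an interval, so nothing lies strictly between p* and m
    no-gap : ¬ (suc (toℕ p*) < toℕ m)
    no-gap gap = t-not-top (top-block-interval w M p*<t t<m wp*≡K (proj₁ last-m))
      where
      t : Fin (suc (suc n))
      t = Fin.fromℕ< (ℕ.<-trans gap (Fin.toℕ<n m))
      p*<t : p* Fin.< t
      p*<t = subst (toℕ p* <_) (sym (Fin.toℕ-fromℕ< (ℕ.<-trans gap (Fin.toℕ<n m)))) ℕ.≤-refl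
      t<m : t Fin.< m
      t<m = subst (_< toℕ m) (sym (Fin.toℕ-fromℕ< (ℕ.<-trans gap (Fin.toℕ<n m)))) gap
      t-not-top : lookup w t ≢ K
      t-not-top wt≡K with pivot⊎punchIn m t
      ... | inj₁ t≡m        = Fin.<⇒≢ t<m t≡m
      ... | inj₂ (t' , t'↦t) = ℕ.<⇒≱ p*<t (subst (Fin._≤ p*) t'↦t (Fin.punchIn-mono-≤ m t' p t'≤p))
        where
        t'≤p : t' Fin.≤ p
        t'≤p = proj₂ last-p t' (trans (ρ≗w∘punchIn t') (trans (cong (lookup w) t'↦t) wt≡K))
    m≡1+p : m ≡ Fin.suc (proj₁ (lastTop ρ))
    m≡1+p = Fin.toℕ-injective (begin
      toℕ m                              ≡⟨ ℕ.≤-antisym (ℕ.≮⇒≥ no-gap) p*<m ⟩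
      suc (toℕ p*)                       ≡⟨ cong suc (toℕ-punchIn-below m p p*<m) ⟩
      suc (toℕ p)                        ≡⟨ cong (suc ∘ toℕ) lastTopρ≡p ⟩
      suc (toℕ (proj₁ (lastTop ρ)))      ∎)
      where open ≡-Reasoning

  ∈-children-removeAt : w ∈ children ρ
  ∈-children-removeAt with lastWith K ρ | lastWith-view K ρ
  ... | nothing | absent K∉ρ = Any.there (subst (_∈ map (newBlockChild ρ) (allFin _))
                                                (sym (new-singleton K∉ρ))
                                                (∈-map⁺ (newBlockChild ρ) (∈-allFin m)))
  ... | just _  | last last-p = Any.here (extended last-p)

∈-children-parent : (w : Vec ℕ (suc (suc n))) → Mton w → w ∈ children (parent w)
∈-children-parent w M = subst (λ ρ → w ∈ children ρ) (sym (parent≡removeAt w (proj₂ (lastTop w))))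
                              (LastTopRemoved.∈-children-removeAt w M)

concatMap-children-unique : {ρs : List (Vec ℕ (suc n))} → Unique ρs → Unique (concatMap children ρs)
concatMap-children-unique ρs! = Unique.concat⁺ (All.map⁺ (All.universal children-unique _))
                                               (AllPairs.map⁺ (AllPairs.map disjoint ρs!))
  where
  disjoint : ∀ {ρ ρ'} → ρ ≢ ρ' → Disjoint (children ρ) (children ρ')
  disjoint ρ≢ρ' (w∈ , w∈') = ρ≢ρ' (trans (sym (parent-children _ w∈)) (parent-children _ w∈'))

NCm-suc↭ : ∀ n → NCm (suc (suc n)) ↭ concatMap children (NCm (suc n))
NCm-suc↭ n = ∼bag⇒↭ (unique∧set⇒bag (NCm-unique _) (concatMap-children-unique (NCm-unique _))
                                    (mk⇔ child-of-parent has-parent))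
  where
  child-of-parent : ∀ {w} → w ∈ NCm (suc (suc n)) → w ∈ concatMap children (NCm (suc n))
  child-of-parent w∈ = let M = ∈-NCm⁻ _ w∈ in
    ∈-concatMap⁺ children (lose (∈-NCm⁺ _ (Mton-parent _ M)) (∈-children-parent _ M))
  has-parent : ∀ {w} → w ∈ concatMap children (NCm (suc n)) → w ∈ NCm (suc (suc n))
  has-parent w∈ = let ρ , ρ∈ , w∈children = find (∈-concatMap⁻ children {xs = NCm (suc n)} w∈) in
    ∈-NCm⁺ _ (Mton-children ρ (∈-NCm⁻ ρ ρ∈) w∈children)

==V⇒≡ : {v w : Vec ℕ n} → T (v ==V w) → v ≡ w
==V⇒≡ {v = v} {w} t with ≡-dec ℕ._≟_ v w
... | yes v≡w = v≡w

≡⇒==V : {v w : Vec ℕ n} → v ≡ w → T (v ==V w)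
≡⇒==V {v = v} refl with ≡-dec ℕ._≟_ v v
... | yes _   = _
... | no  v≢v = v≢v refl

fibre : Vec ℕ (suc n) → List (Vec ℕ (suc (suc n)))
fibre ρ = filterᵇ (λ w → parent w ==V ρ) (NCm _)

fibre↭children : (ρ : Vec ℕ (suc n)) → Mton ρ → fibre ρ ↭ children ρ
fibre↭children ρ M = ∼bag⇒↭ (unique∧set⇒bag (Unique.filter⁺ _ (NCm-unique _)) (children-unique ρ)
                                            (mk⇔ in-fibre⇒child child⇒in-fibre))
  where
  in-fibre⇒child : ∀ {w} → w ∈ fibre ρ → w ∈ children ρ
  in-fibre⇒child {w} w∈ =
    let w∈NCm , parent≡ = ∈-filter⁻ (T? ∘ (λ w → parent w ==V ρ)) {xs = NCm _} w∈
    in subst (λ ρ → w ∈ children ρ) (==V⇒≡ parent≡) (∈-children-parent w (∈-NCm⁻ w w∈NCm))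
  child⇒in-fibre : ∀ {w} → w ∈ children ρ → w ∈ fibre ρ
  child⇒in-fibre {w} w∈ =
    ∈-filter⁺ (T? ∘ (λ w → parent w ==V ρ)) (∈-NCm⁺ w (Mton-children ρ M w∈))
              (≡⇒==V (parent-children ρ w∈))

count-fibre : (ρ : Vec ℕ (suc n)) → Mton ρ → (p : Vec ℕ (suc (suc n)) → Bool) →
  length (filterᵇ (λ w → (parent w ==V ρ) ∧ p w) (NCm (suc (suc n))))
    ≡ length (filterᵇ p (children ρ))
count-fibre ρ M p = trans (cong length (filterᵇ-∧ (λ w → parent w ==V ρ) p (NCm _)))
                          (↭.↭-length (↭.filter-↭ (T? ∘ p) (fibre↭children ρ M)))

length-NCm-suc : ∀ n → length (NCm (suc (suc n))) ≡ suc (suc (suc n)) ℕ.* length (NCm (suc n))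
length-NCm-suc n = trans (↭.↭-length (NCm-suc↭ n))
                         (length-concatMap-const children length-children (NCm (suc n)))

Mton-singleBlock : Mton (Vec.replicate (suc n) 1)
Mton-singleBlock {n} = record
  { positive    = λ i → ℕ.≤-reflexive (sym (all-one i))
  ; onto        = λ j 1≤j j≤k → Fin.zero , sym (is-one 1≤j j≤k)
  ; noncrossing = λ a b _ _ _ _ _ _ _ → trans (all-one a) (sym (all-one b))
  ; monotonic   = λ j l 1≤j j≤k 1≤l l≤k N →
      contradiction (trans (is-one 1≤l l≤k) (sym (is-one 1≤j j≤k))) (Nested⇒≢ (Vec.replicate (suc n) 1) N)
  }
  where
  all-one : ∀ i → lookup (Vec.replicate (suc n) 1) i ≡ 1
  all-one i = Vec.lookup-replicate i 1
  is-one : ∀ {j} → 1 ≤ j → j ≤ numBlocks (Vec.replicate (suc n) 1) → j ≡ 1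
  is-one 1≤j j≤k = ℕ.≤-antisym (ℕ.≤-trans j≤k (numBlocks-least _ (ℕ.≤-reflexive ∘ all-one))) 1≤j

NCm-nonempty : ∀ n → ∃[ c ] length (NCm (suc n)) ≡ suc c
NCm-nonempty n with NCm (suc n) | ∈-NCm⁺ (Vec.replicate (suc n) 1) Mton-singleBlock
... | _ ∷ ws | _ = length ws , refl

-- Expectations

module RecursionStep (α β q : ℤ) (Z : Family) (recursive : RecursiveSecondKind α β q Z) (n : ℕ)
  where

  private
    Co : Vec ℕ (suc (suc n)) → Bool
    Co = proj₁ (recursive (suc n) (s≤s z≤n))

    count : (ρ : Vec ℕ (suc n)) → T (isMton ρ) →
            + length (filterᵇ (λ w → (parent w ==V ρ) ∧ Co w) (NCm (suc (suc n)))) ≡ Z (suc n) ρ + q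
    count = proj₁ (proj₂ (recursive (suc n) (s≤s z≤n)))

    step : (w : Vec ℕ (suc (suc n))) → T (isMton w) →
           Z (suc (suc n)) w ≡ Z (suc n) (parent w) + (if Co w then α else β)
    step = proj₂ (proj₂ (recursive (suc n) (s≤s z≤n)))

    size : ℤ
    size = + suc (suc (suc n))

  slope intercept : ℤ
  slope = size + (α - β)
  intercept = α * q + β * (size - q)

  sum-children : (ρ : Vec ℕ (suc n)) → Mton ρ →
                 sumMap (Z (suc (suc n))) (children ρ) ≡ slope * Z (suc n) ρ + intercept
  sum-children ρ M = begin
    sumMap (Z (suc (suc n))) (children ρ)
      ≡⟨ sumMap-cong step-child ⟩
    sumMap (λ w → z + (if Co w then α else β)) (children ρ)
      ≡⟨ sumMap-+ (λ _ → z) (λ w → if Co w then α else β) (children ρ) ⟩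
    sumMap (λ _ → z) (children ρ) + sumMap (λ w → if Co w then α else β) (children ρ)
      ≡⟨ cong₂ _+_ (sumMap-const z (children ρ)) (sumMap-if α β Co (children ρ)) ⟩
    z * + length (children ρ) + (α * c + β * (+ length (children ρ) - c))
      ≡⟨ cong (λ l → z * + l + (α * c + β * (+ l - c))) (length-children ρ) ⟩
    z * size + (α * c + β * (size - c))
      ≡⟨ cong (λ c → z * size + (α * c + β * (size - c))) c≡z+q ⟩
    z * size + (α * (z + q) + β * (size - (z + q)))
      ≡⟨ regroup z size α β q ⟩
    slope * z + intercept ∎
    where
    open ≡-Reasoning
    z : ℤ
    z = Z (suc n) ρ
    c : ℤ
    c = + length (filterᵇ Co (children ρ))
    c≡z+q : c ≡ z + q
    c≡z+q = trans (cong +_ (sym (count-fibre ρ M Co))) (count ρ (Mton⇒isMton ρ M))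
    step-child : ∀ {w} → w ∈ children ρ → Z (suc (suc n)) w ≡ z + (if Co w then α else β)
    step-child {w} w∈ = trans (step w (Mton⇒isMton w (Mton-children ρ M w∈)))
                              (cong (λ ρ' → Z (suc n) ρ' + (if Co w then α else β)) (parent-children ρ w∈))
    regroup : ∀ z size α β q → z * size + (α * (z + q) + β * (size - (z + q)))
                               ≡ (size + (α - β)) * z + (α * q + β * (size - q))
    regroup = solve-∀

  sum-NCm-suc : sumMap (Z (suc (suc n))) (NCm (suc (suc n)))
                ≡ slope * sumMap (Z (suc n)) (NCm (suc n)) + intercept * + length (NCm (suc n))
  sum-NCm-suc = begin
    sumMap (Z (suc (suc n))) (NCm (suc (suc n)))
      ≡⟨ sumMap-↭ _ (NCm-suc↭ n) ⟩
    sumMap (Z (suc (suc n))) (concatMap children (NCm (suc n)))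
      ≡⟨ sumMap-concatMap (Z (suc (suc n))) children (NCm (suc n)) ⟩
    sumMap (sumMap (Z (suc (suc n))) ∘ children) (NCm (suc n))
      ≡⟨ sumMap-cong (λ {ρ} ρ∈ → sum-children ρ (∈-NCm⁻ ρ ρ∈)) ⟩
    sumMap (λ ρ → slope * Z (suc n) ρ + intercept) (NCm (suc n))
      ≡⟨ sumMap-+ (λ ρ → slope * Z (suc n) ρ) (λ _ → intercept) (NCm (suc n)) ⟩
    sumMap (λ ρ → slope * Z (suc n) ρ) (NCm (suc n)) + sumMap (λ _ → intercept) (NCm (suc n))
      ≡⟨ cong₂ _+_ (sumMap-*ˡ slope (Z (suc n)) (NCm (suc n)))
                   (sumMap-const intercept (NCm (suc n))) ⟩
    slope * sumMap (Z (suc n)) (NCm (suc n)) + intercept * + length (NCm (suc n)) ∎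
    where open ≡-Reasoning

corollary6p2 : (α β q : ℤ) (Z : Family) → RecursiveSecondKind α β q Z →
               (n : ℕ) → 2 ≤ n →
               E Z n ≡ ((+ suc n ℤ.+ (α ℤ.- β)) ℚ./ suc n) ℚ.* E Z (n ∸ 1)
                       ℚ.+ ((α ℤ.* q ℤ.+ β ℤ.* (+ suc n ℤ.- q)) ℚ./ suc n)
-- mean _ 0 = 0, so the recursion relies on NC^(mton)(n-1) being non-empty.
corollary6p2 α β q Z recursive (suc (suc n)) (s≤s (s≤s z≤n)) with NCm-nonempty n
... | c , |NCm|≡1+c = begin
  E Z (suc (suc n))
    ≡⟨ cong₂ mean sum-NCm-suc (length-NCm-suc n) ⟩
  mean (slope * S + intercept * + |NCm|) (suc N ℕ.* |NCm|)
    ≡⟨ cong (λ l → mean (slope * S + intercept * + l) (suc N ℕ.* l)) |NCm|≡1+c ⟩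
  mean (slope * S + intercept * + suc c) (suc N ℕ.* suc c)
    ≡⟨ mean-affine slope intercept S N c ⟩
  (slope ℚ./ suc N) ℚ.* mean S (suc c) ℚ.+ intercept ℚ./ suc N
    ≡⟨ cong (λ l → (slope ℚ./ suc N) ℚ.* mean S l ℚ.+ intercept ℚ./ suc N) |NCm|≡1+c ⟨
  (slope ℚ./ suc N) ℚ.* E Z (suc n) ℚ.+ intercept ℚ./ suc N ∎
  where
  open RecursionStep α β q Z recursive n
  open ≡-Reasoning
  N : ℕ
  N = suc (suc n)
  S : ℤ
  S = sumMap (Z (suc n)) (NCm (suc n))
  |NCm| : ℕ
  |NCm| = length (NCm (suc n))
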